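{- Let $n \ge 5$ and let $A \in \mathbb{F}^{n\times n}$ satisfy property $\mathcal{R}$. Let $S \subseteq [n]$ with $|S| \ge 5$. Then $A[S]$ also satisfies property $\mathcal{R}$.
   Context: For a matrix $M$ whose rows and columns are indexed by a finite set $I$ and $S,T\subseteq I$, $M[S,T]$ denotes the submatrix with rows indexed by $S$ and columns indexed by $T$, $M[S]=M[S,S]$, and $\overline{S} = I\setminus S$. Such a matrix $M$ satisfies property $\mathcal{R}$ if (i) all off-diagonal entries of $M$ are nonzero, and (ii) whenever $i,j,k,\ell \in I$ are distinct with $\mathrm{rank}(M[\{i,j\},\{k,\ell\}]) = 1$, there exists $S \subseteq I$ with $i, j \in S$ and $k, \ell \in \overline{S}$ such that $\mathrm{rank}(M[S, \overline{S}]) = 1$. -}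

module Defs where

open import Level using (Level; _⊔_) renaming (suc to lsuc)
open import Algebra.Bundles using (CommutativeRing)
open import Data.Bool using (Bool; true; false; not; T)
open import Data.Product using (Σ; ∃; _×_; _,_)
open import Data.Sum using (_⊎_)
open import Data.Fin using (Fin)
open import Data.Vec using (lookup)
open import Data.Fin.Subset using (Subset)
open import Relation.Nullary using (¬_)
open import Relation.Unary using (Pred)
open import Relation.Binary.PropositionalEquality using (_≡_; _≢_)

record Field (c ℓ : Level) : Set (lsuc (c ⊔ ℓ)) where
  field
    commutativeRing : CommutativeRing c ℓ
  open CommutativeRing commutativeRing public
  field
    1≉0     : ¬ (1# ≈ 0#)
    inverse : ∀ x → ¬ (x ≈ 0#) → Σ Carrier λ y → x * y ≈ 1#

module _ {c ℓ : Level} (F : Field c ℓ) where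
  open Field F

  Matrix : ∀ {i} → Set i → Set (c ⊔ i)
  Matrix I = I → I → Carrier

  -- rank (M[P , Q]) = 1 : the submatrix is nonzero and all its 2x2 minors vanish.
  RankOne : ∀ {i p q} {I : Set i} → Matrix I → Pred I p → Pred I q → Set (ℓ ⊔ i ⊔ p ⊔ q)
  RankOne {I = I} M P Q =
    (Σ I λ r → Σ I λ s → P r × Q s × ¬ (M r s ≈ 0#)) ×
    (∀ r r' s s' → P r → P r' → Q s → Q s' →
       M r s * M r' s' ≈ M r s' * M r' s)

  -- Property R of the paper. Subsets S ⊆ I are Boolean predicates on I,
  -- and the complement of S is given by  not ∘ S.
  PropertyR : ∀ {i} {I : Set i} → Matrix I → Set (ℓ ⊔ i)
  PropertyR {I = I} M =
    (∀ a b → a ≢ b → ¬ (M a b ≈ 0#)) ×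
    (∀ a b k l → a ≢ b → a ≢ k → a ≢ l → b ≢ k → b ≢ l → k ≢ l →
       RankOne M (λ x → x ≡ a ⊎ x ≡ b) (λ x → x ≡ k ⊎ x ≡ l) →
       Σ (I → Bool) λ S → T (S a) × T (S b) × T (not (S k)) × T (not (S l)) ×
         RankOne M (λ x → T (S x)) (λ x → T (not (S x))))

  Elem : ∀ {n} → Subset n → Set
  Elem {n} S = Σ (Fin n) λ x → T (lookup S x)

  principal : ∀ {n} → Matrix (Fin n) → (S : Subset n) → Matrix (Elem S)
  principal A S (x , _) (y , _) = A x y

{-# OPTIONS --safe #-}
module Submission where

-- A[S] is A reindexed along the injection S → [n], and property R survives any such
-- reindexing: a rank-one 2×2 block of A[S] is one of A, and a separating set S' for A
-- restricts to S' ∩ S, whose block still has vanishing minors and keeps a nonzero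
-- entry because off-diagonal entries are nonzero.

open import Defs
open import Level using (Level; _⊔_)
open import Data.Nat using (ℕ; _≥_)
open import Data.Fin using (Fin)
open import Data.Fin.Subset using (Subset; ∣_∣)
open import Data.Bool using (Bool; not; T)
open import Data.Bool.Properties using (T-irrelevant)
open import Data.Product using (Σ; ∃; _×_; _,_; proj₁)
open import Data.Product.Properties using (Σ-≡,≡→≡)
open import Data.Sum using (_⊎_; inj₁; inj₂)
open import Function using (_∘_; _on_)
open import Function.Definitions using (Injective)
open import Relation.Nullary using (¬_)
open import Relation.Unary using (Pred; _⊆_; _⊢_)
open import Relation.Binary.PropositionalEquality using (_≡_; _≢_; refl)

Pair : ∀ {i} {I : Set i} → I → I → Pred I i
Pair a b x = x ≡ a ⊎ x ≡ b

Image : ∀ {i j p} {I : Set i} {J : Set j} → (J → I) → Pred J p → Pred I (i ⊔ j ⊔ p)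
Image f P x = ∃ λ y → P y × f y ≡ x

Pair-⊆-Image : ∀ {i j} {I : Set i} {J : Set j} (f : J → I) (a b : J) →
               Pair (f a) (f b) ⊆ Image f (Pair a b)
Pair-⊆-Image f a b (inj₁ refl) = a , inj₁ refl , refl
Pair-⊆-Image f a b (inj₂ refl) = b , inj₂ refl , refl

proj₁-injective : ∀ {a} {A : Set a} {P : A → Bool} → Injective _≡_ _≡_ (proj₁ {B = T ∘ P})
proj₁-injective eq = Σ-≡,≡→≡ (eq , T-irrelevant _ _)

module _ {c ℓ : Level} (F : Field c ℓ) where
  open Field F using (_≈_; _*_; 0#)

  MinorsVanish : ∀ {i p q} {I : Set i} → Matrix F I → Pred I p → Pred I q → Set (ℓ ⊔ i ⊔ p ⊔ q)
  MinorsVanish M P Q = ∀ r r' s s' → P r → P r' → Q s → Q s' → M r s * M r' s' ≈ M r s' * M r' s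

  module _ {i j} {I : Set i} {J : Set j} {M : Matrix F I} (f : J → I) where

    minorsVanish-reindex : ∀ {p q} {P : Pred I p} {Q : Pred I q} →
                           MinorsVanish M P Q → MinorsVanish (M on f) (f ⊢ P) (f ⊢ Q)
    minorsVanish-reindex vanish r r' s s' = vanish (f r) (f r') (f s) (f s')

    minorsVanish-image : ∀ {p q} {P : Pred J p} {Q : Pred J q} →
                         MinorsVanish (M on f) P Q → MinorsVanish M (Image f P) (Image f Q)
    minorsVanish-image vanish _ _ _ _ (r , Pr , refl) (r' , Pr' , refl) (s , Qs , refl) (s' , Qs' , refl) =
      vanish r r' s s' Pr Pr' Qs Qs'

  minorsVanish-⊆ : ∀ {i p p' q q'} {I : Set i} {M : Matrix F I}
                   {P : Pred I p} {P' : Pred I p'} {Q : Pred I q} {Q' : Pred I q'} →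
                   P' ⊆ P → Q' ⊆ Q → MinorsVanish M P Q → MinorsVanish M P' Q'
  minorsVanish-⊆ P'⊆P Q'⊆Q vanish r r' s s' Pr Pr' Qs Qs' =
    vanish r r' s s' (P'⊆P Pr) (P'⊆P Pr') (Q'⊆Q Qs) (Q'⊆Q Qs')

  RankOneCut : ∀ {i} {I : Set i} → Matrix F I → I → I → I → I → Set (ℓ ⊔ i)
  RankOneCut {I = I} M a b k l =
    Σ (I → Bool) λ S → T (S a) × T (S b) × T (not (S k)) × T (not (S l)) ×
      RankOne F M (T ∘ S) (T ∘ not ∘ S)

  PropertyR-reindex : ∀ {i j} {I : Set i} {J : Set j} {M : Matrix F I} (f : J → I) →
                      Injective _≡_ _≡_ f → PropertyR F M → PropertyR F (M on f)
  PropertyR-reindex {M = M} f f-inj (nonzero , split) = nonzero-on , split-on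
    where
    f-≢ : ∀ {x y} → x ≢ y → f x ≢ f y
    f-≢ x≢y = x≢y ∘ f-inj

    nonzero-on : ∀ x y → x ≢ y → ¬ (M (f x) (f y) ≈ 0#)
    nonzero-on x y x≢y = nonzero (f x) (f y) (f-≢ x≢y)

    split-on : ∀ a b k l → a ≢ b → a ≢ k → a ≢ l → b ≢ k → b ≢ l → k ≢ l →
               RankOne F (M on f) (Pair a b) (Pair k l) → RankOneCut (M on f) a b k l
    split-on a b k l ab ak al bk bl kl (_ , vanish)
      with split (f a) (f b) (f k) (f l) (f-≢ ab) (f-≢ ak) (f-≢ al) (f-≢ bk) (f-≢ bl) (f-≢ kl)
                 ( (f a , f k , inj₁ refl , inj₁ refl , nonzero-on a k ak)
                 , minorsVanish-⊆ (Pair-⊆-Image f a b) (Pair-⊆-Image f k l) (minorsVanish-image f vanish))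
    ... | S , Sa , Sb , ¬Sk , ¬Sl , _ , vanishS =
      S ∘ f , Sa , Sb , ¬Sk , ¬Sl , (a , k , Sa , ¬Sk , nonzero-on a k ak) , minorsVanish-reindex f vanishS

lemma5p2 : ∀ {c ℓ : Level} (F : Field c ℓ) (n : ℕ) → n ≥ 5 →
    (A : Matrix F (Fin n)) → PropertyR F A →
    (S : Subset n) → ∣ S ∣ ≥ 5 →
    PropertyR F (principal F A S)
lemma5p2 F n _ A R S _ = PropertyR-reindex F proj₁ proj₁-injective R
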